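{- Given a proof in intuitionistic propositional logic (NJ) of $\Gamma\vdash\phi$, one can inductively define (by induction on the proof and on the syntactic structure of the formulae occurring in it) a morphism $\llbracket\Gamma\rrbracket\to\llbracket\phi\rrbracket$ in the presheaf topos $[\mathcal W^{op},\mathbf{Set}]$, i.e. a natural transformation between these functors.
   Context: Fix a countable set $\mathbb A$ of atoms; formulae are built from atoms and $\bot$ with $\wedge,\vee,\supset$; NJ is standard natural deduction for intuitionistic propositional logic. An atomic rule is $\mathcal R=((P_1\Rightarrow q_1),\dots,(P_n\Rightarrow q_n))\Rightarrow r$ with $n\ge0$, $P_i$ finite sets of atoms, $q_i,r$ atoms. A base is a countable set of atomic rules. A context $(X:P)$ is a finite list $x_1:p_1,\dots,x_m:p_m$. Derivation terms $\Phi::=x\mid\Phi_{\mathcal R}(\Phi_1,\dots,\Phi_n)$; derivations in base $\mathcal B$ generated by $(X:P),x:p\vdash_{\mathcal B}x:p$ and, for $\mathcal R\in\mathcal B$, from $(X:P),(X_i:P_i)\vdash_{\mathcal B}\Phi_i:q_i$ infer $(X:P)\vdash_{\mathcal B}\Phi_{\mathcal R}(\Phi_1,\dots,\Phi_n):r$. The category $\mathcal W$ has objects $(\mathcal B,(X:P))$; a morphism $(\mathcal B,(X:P))\to(\mathcal C,(Y:Q))$, $Y:Q=y_1:q_1,\dots,y_m:q_m$, exists only when $\mathcal C\subseteq\mathcal B$ and is a tuple of derivations $(X:P)\vdash_{\mathcal B}\Phi_i:q_i$; identities are variable tuples, composition is simultaneous substitution. For presheaves $F,G$: $F\times G$ pointwise;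 $(F\supset G)(w)$ = natural transformations $\mathcal W(-,w)\times F\to G$. Interpretation: $\llbracket p\rrbracket(\mathcal B,(X:P))$ = set of derivations $(X:P)\vdash_{\mathcal B}\Phi:p$, action by substitution; $\llbracket\phi\wedge\psi\rrbracket=\llbracket\phi\rrbracket\times\llbracket\psi\rrbracket$; $\llbracket\phi\supset\psi\rrbracket=\llbracket\phi\rrbracket\supset\llbracket\psi\rrbracket$; $\llbracket\phi\vee\psi\rrbracket=\prod_{p\in\mathbb A}\big((\llbracket\phi\rrbracket\supset\llbracket p\rrbracket)\supset((\llbracket\psi\rrbracket\supset\llbracket p\rrbracket)\supset\llbracket p\rrbracket)\big)$; $\llbracket\bot\rrbracket=\prod_{p\in\mathbb A}\llbracket p\rrbracket$; $\llbracket\Gamma\rrbracket$ = product over $\Gamma$ (terminal if empty). -}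

module Defs where

open import Level using (Level; Lift; lift; lower) renaming (suc to lsuc; zero to lzero)
open import Data.Nat using (ℕ)
open import Data.Unit using (⊤; tt)
open import Data.Product using (Σ; _×_; _,_; proj₁; proj₂)
open import Data.List using (List; []; _∷_; _++_)
open import Data.List.Membership.Propositional using (_∈_)
open import Data.List.Relation.Unary.Any using (here; there)
open import Data.List.Relation.Unary.All as All using (All; []; _∷_)
open import Relation.Binary.Structures using (IsEquivalence)
open import Relation.Binary.PropositionalEquality
  using (_≡_; refl; sym; trans; cong; cong₂; subst; isEquivalence)

Atom : Set
Atom = ℕ

infixr 6 _∧_
infixr 5 _∨_
infixr 4 _⊃_

data Formula : Set where
  at     : Atom → Formula
  falsum : Formula
  _∧_    : Formula → Formula → Formula
  _∨_    : Formula → Formula → Formula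
  _⊃_    : Formula → Formula → Formula

FCtx : Set
FCtx = List Formula

infix 3 _⊢_

data _⊢_ (Γ : FCtx) : Formula → Set where
  ax   : ∀ {φ} → φ ∈ Γ → Γ ⊢ φ
  ∧I   : ∀ {φ ψ} → Γ ⊢ φ → Γ ⊢ ψ → Γ ⊢ φ ∧ ψ
  ∧E₁  : ∀ {φ ψ} → Γ ⊢ φ ∧ ψ → Γ ⊢ φ
  ∧E₂  : ∀ {φ ψ} → Γ ⊢ φ ∧ ψ → Γ ⊢ ψ
  ∨I₁  : ∀ {φ ψ} → Γ ⊢ φ → Γ ⊢ φ ∨ ψ
  ∨I₂  : ∀ {φ ψ} → Γ ⊢ ψ → Γ ⊢ φ ∨ ψ
  ∨E   : ∀ {φ ψ χ} → Γ ⊢ φ ∨ ψ → (φ ∷ Γ) ⊢ χ → (ψ ∷ Γ) ⊢ χ → Γ ⊢ χ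
  ⊃I   : ∀ {φ ψ} → (φ ∷ Γ) ⊢ ψ → Γ ⊢ φ ⊃ ψ
  ⊃E   : ∀ {φ ψ} → Γ ⊢ φ ⊃ ψ → Γ ⊢ φ → Γ ⊢ ψ
  ⊥E   : ∀ {φ} → Γ ⊢ falsum → Γ ⊢ φ

-- A premise (P ⇒ q): the finite set P of atoms is given as a list.
Premise : Set
Premise = List Atom × Atom

record Rule : Set where
  constructor _⇛_
  field
    prems : List Premise
    concl : Atom
open Rule public

-- A base is a set of atomic rules (automatically countable, since the
-- set of all atomic rules is countable).
Base : Set₁
Base = Rule → Set

_⊆ᴮ_ : Base → Base → Set
C ⊆ᴮ B = ∀ R → C R → B R

-- Atomic contexts (X : P), variables as de Bruijn indices (positions).
Ctx : Set
Ctx = List Atom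

-- Derivation terms: x | Φ_R(Φ₁,…,Φₙ). The premise i is derived in the
-- context (X:P),(X_i:P_i), represented as P_i ++ P.
mutual
  data Der (B : Base) (Δ : Ctx) : Atom → Set where
    var  : ∀ {p} → p ∈ Δ → Der B Δ p
    rule : (R : Rule) → .(B R) → Ders B Δ (prems R) → Der B Δ (concl R)

  data Ders (B : Base) (Δ : Ctx) : List Premise → Set where
    []ᵈ  : Ders B Δ []
    _∷ᵈ_ : ∀ {P q ps} → Der B (P ++ Δ) q → Ders B Δ ps → Ders B Δ ((P , q) ∷ ps)

Ren : Ctx → Ctx → Set
Ren Δ Δ' = ∀ {q} → q ∈ Δ → q ∈ Δ'

liftʳ : ∀ {Δ Δ'} P → Ren Δ Δ' → Ren (P ++ Δ) (P ++ Δ')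
liftʳ []      ρ x         = ρ x
liftʳ (p ∷ P) ρ (here e)  = here e
liftʳ (p ∷ P) ρ (there x) = there (liftʳ P ρ x)

mutual
  ren : ∀ {B Δ Δ' r} → Ren Δ Δ' → Der B Δ r → Der B Δ' r
  ren ρ (var x)       = var (ρ x)
  ren ρ (rule R b ds) = rule R b (rens ρ ds)

  rens : ∀ {B Δ Δ' ps} → Ren Δ Δ' → Ders B Δ ps → Ders B Δ' ps
  rens ρ []ᵈ                = []ᵈ
  rens ρ (_∷ᵈ_ {P} d ds)    = ren (liftʳ P ρ) d ∷ᵈ rens ρ ds

Sub : Base → Ctx → Ctx → Set
Sub B Θ Δ = ∀ {q} → q ∈ Θ → Der B Δ q

liftˢ : ∀ {B Θ Δ} P → Sub B Θ Δ → Sub B (P ++ Θ) (P ++ Δ)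
liftˢ []      σ x         = σ x
liftˢ (p ∷ P) σ (here e)  = var (here e)
liftˢ (p ∷ P) σ (there x) = ren there (liftˢ P σ x)

mutual
  sub : ∀ {B C Θ Δ r} → .(C ⊆ᴮ B) → Sub B Θ Δ → Der C Θ r → Der B Δ r
  sub i σ (var x)       = σ x
  sub i σ (rule R c ds) = rule R (i R c) (subs i σ ds)

  subs : ∀ {B C Θ Δ ps} → .(C ⊆ᴮ B) → Sub B Θ Δ → Ders C Θ ps → Ders B Δ ps
  subs i σ []ᵈ             = []ᵈ
  subs i σ (_∷ᵈ_ {P} d ds) = sub i (liftˢ P σ) d ∷ᵈ subs i σ ds

liftʳ-cong : ∀ {Δ Δ'} P {ρ ρ' : Ren Δ Δ'} → (∀ {q} (x : q ∈ Δ) → ρ x ≡ ρ' x)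
           → ∀ {q} (x : q ∈ P ++ Δ) → liftʳ P ρ x ≡ liftʳ P ρ' x
liftʳ-cong []      e x         = e x
liftʳ-cong (p ∷ P) e (here _)  = refl
liftʳ-cong (p ∷ P) e (there x) = cong there (liftʳ-cong P e x)

mutual
  ren-cong : ∀ {B Δ Δ' r} {ρ ρ' : Ren Δ Δ'} → (∀ {q} (x : q ∈ Δ) → ρ x ≡ ρ' x)
           → (t : Der B Δ r) → ren ρ t ≡ ren ρ' t
  ren-cong e (var x)       = cong var (e x)
  ren-cong e (rule R b ds) = cong (rule R b) (rens-cong e ds)

  rens-cong : ∀ {B Δ Δ' ps} {ρ ρ' : Ren Δ Δ'} → (∀ {q} (x : q ∈ Δ) → ρ x ≡ ρ' x)
            → (ds : Ders B Δ ps) → rens ρ ds ≡ rens ρ' ds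
  rens-cong e []ᵈ             = refl
  rens-cong e (_∷ᵈ_ {P} d ds) = cong₂ _∷ᵈ_ (ren-cong (liftʳ-cong P e) d) (rens-cong e ds)

liftʳ-∘ : ∀ {Δ₁ Δ₂ Δ₃} P (ρ : Ren Δ₂ Δ₃) (ρ' : Ren Δ₁ Δ₂)
        → ∀ {q} (x : q ∈ P ++ Δ₁) → liftʳ P ρ (liftʳ P ρ' x) ≡ liftʳ P (λ y → ρ (ρ' y)) x
liftʳ-∘ []      ρ ρ' x         = refl
liftʳ-∘ (p ∷ P) ρ ρ' (here _)  = refl
liftʳ-∘ (p ∷ P) ρ ρ' (there x) = cong there (liftʳ-∘ P ρ ρ' x)

mutual
  ren-ren : ∀ {B Δ₁ Δ₂ Δ₃ r} (ρ : Ren Δ₂ Δ₃) (ρ' : Ren Δ₁ Δ₂) (t : Der B Δ₁ r)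
          → ren ρ (ren ρ' t) ≡ ren (λ y → ρ (ρ' y)) t
  ren-ren ρ ρ' (var x)       = refl
  ren-ren ρ ρ' (rule R b ds) = cong (rule R b) (rens-rens ρ ρ' ds)

  rens-rens : ∀ {B Δ₁ Δ₂ Δ₃ ps} (ρ : Ren Δ₂ Δ₃) (ρ' : Ren Δ₁ Δ₂) (ds : Ders B Δ₁ ps)
            → rens ρ (rens ρ' ds) ≡ rens (λ y → ρ (ρ' y)) ds
  rens-rens ρ ρ' []ᵈ             = refl
  rens-rens ρ ρ' (_∷ᵈ_ {P} d ds) =
    cong₂ _∷ᵈ_ (trans (ren-ren (liftʳ P ρ) (liftʳ P ρ') d) (ren-cong (liftʳ-∘ P ρ ρ') d))
               (rens-rens ρ ρ' ds)

liftˢ-cong : ∀ {B Θ Δ} P {σ σ' : Sub B Θ Δ} → (∀ {q} (x : q ∈ Θ) → σ x ≡ σ' x)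
           → ∀ {q} (x : q ∈ P ++ Θ) → liftˢ P σ x ≡ liftˢ P σ' x
liftˢ-cong []      e x         = e x
liftˢ-cong (p ∷ P) e (here _)  = refl
liftˢ-cong (p ∷ P) e (there x) = cong (ren there) (liftˢ-cong P e x)

mutual
  sub-cong : ∀ {B C Θ Δ r} .(i : C ⊆ᴮ B) {σ σ' : Sub B Θ Δ} → (∀ {q} (x : q ∈ Θ) → σ x ≡ σ' x)
           → (t : Der C Θ r) → sub i σ t ≡ sub i σ' t
  sub-cong i e (var x)       = e x
  sub-cong i e (rule R c ds) = cong (rule R (i R c)) (subs-cong i e ds)

  subs-cong : ∀ {B C Θ Δ ps} .(i : C ⊆ᴮ B) {σ σ' : Sub B Θ Δ} → (∀ {q} (x : q ∈ Θ) → σ x ≡ σ' x)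
            → (ds : Ders C Θ ps) → subs i σ ds ≡ subs i σ' ds
  subs-cong i e []ᵈ             = refl
  subs-cong i e (_∷ᵈ_ {P} d ds) = cong₂ _∷ᵈ_ (sub-cong i (liftˢ-cong P e) d) (subs-cong i e ds)

liftˢ-var : ∀ {B Δ} P → ∀ {q} (x : q ∈ P ++ Δ) → liftˢ {B} {Δ} P var x ≡ var x
liftˢ-var []      x         = refl
liftˢ-var (p ∷ P) (here _)  = refl
liftˢ-var (p ∷ P) (there x) = cong (ren there) (liftˢ-var P x)

mutual
  sub-var : ∀ {B Δ r} (t : Der B Δ r) → sub (λ R b → b) var t ≡ t
  sub-var (var x)       = refl
  sub-var (rule R b ds) = cong (rule R b) (subs-var ds)

  subs-var : ∀ {B Δ ps} (ds : Ders B Δ ps) → subs (λ R b → b) var ds ≡ ds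
  subs-var []ᵈ             = refl
  subs-var (_∷ᵈ_ {P} d ds) =
    cong₂ _∷ᵈ_ (trans (sub-cong (λ R b → b) (liftˢ-var P) d) (sub-var d)) (subs-var ds)

liftˢ-ren : ∀ {B Θ Θ' Δ} P (σ : Sub B Θ' Δ) (ρ : Ren Θ Θ')
          → ∀ {q} (x : q ∈ P ++ Θ) → liftˢ P σ (liftʳ P ρ x) ≡ liftˢ P (λ y → σ (ρ y)) x
liftˢ-ren []      σ ρ x         = refl
liftˢ-ren (p ∷ P) σ ρ (here _)  = refl
liftˢ-ren (p ∷ P) σ ρ (there x) = cong (ren there) (liftˢ-ren P σ ρ x)

mutual
  sub-ren : ∀ {B C Θ Θ' Δ r} .(i : C ⊆ᴮ B) (σ : Sub B Θ' Δ) (ρ : Ren Θ Θ') (t : Der C Θ r)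
          → sub i σ (ren ρ t) ≡ sub i (λ y → σ (ρ y)) t
  sub-ren i σ ρ (var x)       = refl
  sub-ren i σ ρ (rule R c ds) = cong (rule R (i R c)) (subs-rens i σ ρ ds)

  subs-rens : ∀ {B C Θ Θ' Δ ps} .(i : C ⊆ᴮ B) (σ : Sub B Θ' Δ) (ρ : Ren Θ Θ') (ds : Ders C Θ ps)
            → subs i σ (rens ρ ds) ≡ subs i (λ y → σ (ρ y)) ds
  subs-rens i σ ρ []ᵈ             = refl
  subs-rens i σ ρ (_∷ᵈ_ {P} d ds) =
    cong₂ _∷ᵈ_ (trans (sub-ren i (liftˢ P σ) (liftʳ P ρ) d) (sub-cong i (liftˢ-ren P σ ρ) d))
               (subs-rens i σ ρ ds)

ren-liftˢ : ∀ {B Θ Δ Δ'} P (ρ : Ren Δ Δ') (σ : Sub B Θ Δ)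
          → ∀ {q} (x : q ∈ P ++ Θ) → ren (liftʳ P ρ) (liftˢ P σ x) ≡ liftˢ P (λ y → ren ρ (σ y)) x
ren-liftˢ []      ρ σ x         = refl
ren-liftˢ (p ∷ P) ρ σ (here _)  = refl
ren-liftˢ (p ∷ P) ρ σ (there x) =
  trans (ren-ren (liftʳ (p ∷ P) ρ) there (liftˢ P σ x))
        (trans (sym (ren-ren there (liftʳ P ρ) (liftˢ P σ x)))
               (cong (ren there) (ren-liftˢ P ρ σ x)))

mutual
  ren-sub : ∀ {B C Θ Δ Δ' r} .(i : C ⊆ᴮ B) (ρ : Ren Δ Δ') (σ : Sub B Θ Δ) (t : Der C Θ r)
          → ren ρ (sub i σ t) ≡ sub i (λ y → ren ρ (σ y)) t
  ren-sub i ρ σ (var x)       = refl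
  ren-sub i ρ σ (rule R c ds) = cong (rule R (i R c)) (rens-subs i ρ σ ds)

  rens-subs : ∀ {B C Θ Δ Δ' ps} .(i : C ⊆ᴮ B) (ρ : Ren Δ Δ') (σ : Sub B Θ Δ) (ds : Ders C Θ ps)
            → rens ρ (subs i σ ds) ≡ subs i (λ y → ren ρ (σ y)) ds
  rens-subs i ρ σ []ᵈ             = refl
  rens-subs i ρ σ (_∷ᵈ_ {P} d ds) =
    cong₂ _∷ᵈ_ (trans (ren-sub i (liftʳ P ρ) (liftˢ P σ) d) (sub-cong i (ren-liftˢ P ρ σ) d))
               (rens-subs i ρ σ ds)

liftˢ-sub : ∀ {B C Ξ Θ Δ} P .(i : C ⊆ᴮ B) (σ : Sub B Θ Δ) (τ : Sub C Ξ Θ)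
          → ∀ {q} (x : q ∈ P ++ Ξ) → sub i (liftˢ P σ) (liftˢ P τ x) ≡ liftˢ P (λ y → sub i σ (τ y)) x
liftˢ-sub []      i σ τ x         = refl
liftˢ-sub (p ∷ P) i σ τ (here _)  = refl
liftˢ-sub (p ∷ P) i σ τ (there x) =
  trans (sub-ren i (liftˢ (p ∷ P) σ) there (liftˢ P τ x))
        (trans (sym (ren-sub i there (liftˢ P σ) (liftˢ P τ x)))
               (cong (ren there) (liftˢ-sub P i σ τ x)))

mutual
  sub-sub : ∀ {B C D Ξ Θ Δ r} .(i : C ⊆ᴮ B) .(j : D ⊆ᴮ C) (σ : Sub B Θ Δ) (τ : Sub C Ξ Θ)
            (t : Der D Ξ r)
          → sub i σ (sub j τ t) ≡ sub (λ R d → i R (j R d)) (λ y → sub i σ (τ y)) t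
  sub-sub i j σ τ (var x)       = refl
  sub-sub i j σ τ (rule R d ds) = cong (rule R (i R (j R d))) (subs-subs i j σ τ ds)

  subs-subs : ∀ {B C D Ξ Θ Δ ps} .(i : C ⊆ᴮ B) .(j : D ⊆ᴮ C) (σ : Sub B Θ Δ) (τ : Sub C Ξ Θ)
              (ds : Ders D Ξ ps)
            → subs i σ (subs j τ ds) ≡ subs (λ R d → i R (j R d)) (λ y → sub i σ (τ y)) ds
  subs-subs i j σ τ []ᵈ             = refl
  subs-subs i j σ τ (_∷ᵈ_ {P} d ds) =
    cong₂ _∷ᵈ_ (trans (sub-sub i j (liftˢ P σ) (liftˢ P τ) d)
                      (sub-cong (λ R d → i R (j R d)) (liftˢ-sub P i σ τ) d))
               (subs-subs i j σ τ ds)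

Obj : Set₁
Obj = Σ Base (λ _ → Ctx)

-- A morphism (𝓑,(X:P)) → (𝓒,(Y:Q)) exists only when 𝓒 ⊆ 𝓑 (an
-- irrelevant side condition) and is a tuple of derivations (X:P) ⊢_𝓑 Φᵢ : qᵢ.
record Hom (v w : Obj) : Set where
  constructor hom
  field
    .inc : proj₁ w ⊆ᴮ proj₁ v
    tup  : All (Der (proj₁ v) (proj₂ v)) (proj₂ w)
open Hom public

idH : ∀ {w} → Hom w w
idH = hom (λ R b → b) (All.tabulate var)

infixr 9 _∘H_
_∘H_ : ∀ {u v w} → Hom v w → Hom u v → Hom u w
hom j s ∘H hom i t = hom (λ R c → i R (j R c)) (All.map (sub i (All.lookup t)) s)

actD : ∀ {v w r} → Hom v w → Der (proj₁ w) (proj₂ w) r → Der (proj₁ v) (proj₂ v) r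
actD (hom i s) t = sub i (All.lookup s) t

private
  All-ext : ∀ {a} {A : Set a} {P : A → Set} {xs : List A} (ys zs : All P xs)
          → (∀ {x} (i : x ∈ xs) → All.lookup ys i ≡ All.lookup zs i) → ys ≡ zs
  All-ext []       []       e = refl
  All-ext (y ∷ ys) (z ∷ zs) e = cong₂ _∷_ (e (here refl)) (All-ext ys zs (λ i → e (there i)))

  lookup-tab : ∀ {a} {A : Set a} {P : A → Set} {xs : List A} (g : ∀ {x} → x ∈ xs → P x)
             → ∀ {x} (i : x ∈ xs) → All.lookup (All.tabulate g) i ≡ g i
  lookup-tab g (here refl) = refl
  lookup-tab g (there i)   = lookup-tab (λ j → g (there j)) i

  lookup-map′ : ∀ {a} {A : Set a} {P Q : A → Set} {xs : List A} (h : ∀ {x} → P x → Q x)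
                (ys : All P xs) → ∀ {x} (i : x ∈ xs) → All.lookup (All.map h ys) i ≡ h (All.lookup ys i)
  lookup-map′ h (y ∷ ys) (here refl) = refl
  lookup-map′ h (y ∷ ys) (there i)   = lookup-map′ h ys i

hom-ext : ∀ {v w} {f g : Hom v w} → tup f ≡ tup g → f ≡ g
hom-ext {f = hom i t} {hom j .t} refl = refl

idˡ : ∀ {v w} (f : Hom v w) → idH ∘H f ≡ f
idˡ (hom i t) = hom-ext (All-ext _ _ λ x →
  trans (lookup-map′ (sub i (All.lookup t)) (All.tabulate var) x)
        (cong (sub i (All.lookup t)) (lookup-tab var x)))

assoc : ∀ {t u v w} (h : Hom v w) (g : Hom u v) (f : Hom t u) → (h ∘H g) ∘H f ≡ h ∘H (g ∘H f)
assoc (hom k r) (hom j s) (hom i t) = hom-ext (All-ext _ _ λ x →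
  trans (lookup-map′ (sub i (All.lookup t)) (All.map (sub j (All.lookup s)) r) x)
  (trans (cong (sub i (All.lookup t)) (lookup-map′ (sub j (All.lookup s)) r x))
  (trans (sub-sub i j (All.lookup t) (All.lookup s) (All.lookup r x))
  (trans (sym (sub-cong (λ R d → i R (j R d)) (lookup-map′ (sub i (All.lookup t)) s)
                        (All.lookup r x)))
         (sym (lookup-map′ (sub (λ R d → i R (j R d)) (All.lookup (All.map (sub i (All.lookup t)) s))) r x))))))

actD-id : ∀ {w r} (t : Der (proj₁ w) (proj₂ w) r) → actD (idH {w}) t ≡ t
actD-id t = trans (sub-cong (λ R b → b) (lookup-tab var) t) (sub-var t)

actD-∘ : ∀ {u v w r} (g : Hom v w) (f : Hom u v) (t : Der (proj₁ w) (proj₂ w) r)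
       → actD (g ∘H f) t ≡ actD f (actD g t)
actD-∘ (hom j s) (hom i u) t =
  trans (sub-cong (λ R d → i R (j R d)) (lookup-map′ (sub i (All.lookup u)) s) t)
        (sym (sub-sub i j (All.lookup u) (All.lookup s) t))

-- Presheaves on 𝒲 (setoid-valued, since elements of exponentials are
-- natural transformations and are compared extensionally)

record PSh : Set₂ where
  field
    Ob       : Obj → Set₁
    _≈_      : ∀ {w} → Ob w → Ob w → Set₁
    ≈-equiv  : ∀ {w} → IsEquivalence (_≈_ {w})
    act      : ∀ {v w} → Hom v w → Ob w → Ob v
    act-cong : ∀ {v w} (f : Hom v w) {x y : Ob w} → x ≈ y → act f x ≈ act f y
    act-id   : ∀ {w} (x : Ob w) → act idH x ≈ x
    act-∘    : ∀ {u v w} (g : Hom v w) (f : Hom u v) (x : Ob w) → act (g ∘H f) x ≈ act f (act g x)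

record NatTrans (F G : PSh) : Set₁ where
  private
    module F = PSh F
    module G = PSh G
  field
    η     : ∀ w → F.Ob w → G.Ob w
    η-cong : ∀ w {x y : F.Ob w} → F._≈_ x y → G._≈_ (η w x) (η w y)
    η-nat  : ∀ {v w} (f : Hom v w) (x : F.Ob w) → G._≈_ (η v (F.act f x)) (G.act f (η w x))

𝟙 : PSh
𝟙 = record
  { Ob = λ _ → Lift _ ⊤ ; _≈_ = λ _ _ → Lift _ ⊤
  ; ≈-equiv = record { refl = lift tt ; sym = λ _ → lift tt ; trans = λ _ _ → lift tt }
  ; act = λ _ _ → lift tt ; act-cong = λ _ _ → lift tt
  ; act-id = λ _ → lift tt ; act-∘ = λ _ _ _ → lift tt }

infixr 6 _⊗_
_⊗_ : PSh → PSh → PSh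
F ⊗ G = record
  { Ob = λ w → F.Ob w × G.Ob w
  ; _≈_ = λ x y → F._≈_ (proj₁ x) (proj₁ y) × G._≈_ (proj₂ x) (proj₂ y)
  ; ≈-equiv = record
      { refl = FE.refl , GE.refl
      ; sym = λ e → FE.sym (proj₁ e) , GE.sym (proj₂ e)
      ; trans = λ e e' → FE.trans (proj₁ e) (proj₁ e') , GE.trans (proj₂ e) (proj₂ e') }
  ; act = λ f x → F.act f (proj₁ x) , G.act f (proj₂ x)
  ; act-cong = λ f e → F.act-cong f (proj₁ e) , G.act-cong f (proj₂ e)
  ; act-id = λ x → F.act-id (proj₁ x) , G.act-id (proj₂ x)
  ; act-∘ = λ g f x → F.act-∘ g f (proj₁ x) , G.act-∘ g f (proj₂ x) }
  where
    module F = PSh F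
    module G = PSh G
    module FE {w} = IsEquivalence (F.≈-equiv {w})
    module GE {w} = IsEquivalence (G.≈-equiv {w})

Π𝔸 : (Atom → PSh) → PSh
Π𝔸 F = record
  { Ob = λ w → (p : Atom) → Ob (F p) w
  ; _≈_ = λ x y → (p : Atom) → _≈_ (F p) (x p) (y p)
  ; ≈-equiv = record
      { refl = λ p → IsEquivalence.refl (≈-equiv (F p))
      ; sym = λ e p → IsEquivalence.sym (≈-equiv (F p)) (e p)
      ; trans = λ e e' p → IsEquivalence.trans (≈-equiv (F p)) (e p) (e' p) }
  ; act = λ f x p → act (F p) f (x p)
  ; act-cong = λ f e p → act-cong (F p) f (e p)
  ; act-id = λ x p → act-id (F p) (x p)
  ; act-∘ = λ g f x p → act-∘ (F p) g f (x p) }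
  where open PSh

-- elements of the exponential (F ⊃ G)(w): natural transformations 𝒲(-,w) × F → G
record ExpOb (F G : PSh) (w : Obj) : Set₁ where
  private
    module F = PSh F
    module G = PSh G
  field
    fun     : ∀ {v} → Hom v w → F.Ob v → G.Ob v
    fun-cong : ∀ {v} (f : Hom v w) {x y : F.Ob v} → F._≈_ x y → G._≈_ (fun f x) (fun f y)
    fun-nat  : ∀ {u v} (f : Hom v w) (g : Hom u v) (x : F.Ob v)
             → G._≈_ (fun (f ∘H g) (F.act g x)) (G.act g (fun f x))
open ExpOb public

infixr 4 _⇒_
_⇒_ : PSh → PSh → PSh
F ⇒ G = record
  { Ob = ExpOb F G
  ; _≈_ = λ {w} α β → ∀ {v} (f : Hom v w) (x : F.Ob v) → G._≈_ (fun α f x) (fun β f x)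
  ; ≈-equiv = record
      { refl = λ f x → GE.refl
      ; sym = λ e f x → GE.sym (e f x)
      ; trans = λ e e' f x → GE.trans (e f x) (e' f x) }
  ; act = λ h α → record
      { fun = λ f x → fun α (h ∘H f) x
      ; fun-cong = λ f e → fun-cong α (h ∘H f) e
      ; fun-nat = λ f g x →
          subst (λ k → G._≈_ (fun α k (F.act g x)) (G.act g (fun α (h ∘H f) x)))
                (assoc h f g) (fun-nat α (h ∘H f) g x) }
  ; act-cong = λ h e f x → e (h ∘H f) x
  ; act-id = λ α f x → subst (λ k → G._≈_ (fun α k x) (fun α f x)) (sym (idˡ f)) GE.refl
  ; act-∘ = λ g f α k x → subst (λ m → G._≈_ (fun α ((g ∘H f) ∘H k) x) (fun α m x)) (assoc g f k) GE.refl }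
  where
    module F = PSh F
    module G = PSh G
    module GE {w} = IsEquivalence (G.≈-equiv {w})

Atomic : Atom → PSh
Atomic p = record
  { Ob = λ w → Lift (lsuc lzero) (Der (proj₁ w) (proj₂ w) p)
  ; _≈_ = _≡_
  ; ≈-equiv = isEquivalence
  ; act = λ f x → lift (actD f (lower x))
  ; act-cong = λ f e → cong (λ x → lift (actD f (lower x))) e
  ; act-id = λ x → cong lift (actD-id (lower x))
  ; act-∘ = λ g f x → cong lift (actD-∘ g f (lower x)) }

⟦_⟧ : Formula → PSh
⟦ at p ⟧   = Atomic p
⟦ falsum ⟧ = Π𝔸 Atomic
⟦ φ ∧ ψ ⟧  = ⟦ φ ⟧ ⊗ ⟦ ψ ⟧
⟦ φ ⊃ ψ ⟧  = ⟦ φ ⟧ ⇒ ⟦ ψ ⟧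
⟦ φ ∨ ψ ⟧  = Π𝔸 (λ p → (⟦ φ ⟧ ⇒ Atomic p) ⇒ ((⟦ ψ ⟧ ⇒ Atomic p) ⇒ Atomic p))

⟦_⟧ᶜ : FCtx → PSh
⟦ [] ⟧ᶜ    = 𝟙
⟦ φ ∷ Γ ⟧ᶜ = ⟦ φ ⟧ ⊗ ⟦ Γ ⟧ᶜ

module Submission where

open import Data.Product using (_,_; proj₁; proj₂)
open import Data.List.Relation.Unary.Any using (here; there)
open import Data.List.Relation.Unary.All.Properties using (map-cong; map-id)
open import Data.List.Membership.Propositional using (_∈_)
open import Relation.Binary.Structures using (IsEquivalence)
open import Relation.Binary.PropositionalEquality using (_≡_; refl; sym; trans; subst)
open import Defs

-- The rules for ∧ and ⊃ are sound because the presheaf category is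
-- cartesian closed.  The interesting cases are ∨E and ⊥E: ⟦ φ ∨ ψ ⟧ and
-- ⟦ ⊥ ⟧ are products over the atoms, so a priori they only eliminate into
-- the presheaves Atomic p.  But every ⟦ χ ⟧ is built from the Atomic p by
-- products (binary and over 𝔸) and exponentials F ⇒ -, and elimination
-- into a presheaf lifts along each of these constructions, so both
-- connectives eliminate into every ⟦ χ ⟧.

open NatTrans

module ≈ (F : PSh) {w : Obj} = IsEquivalence (PSh.≈-equiv F {w})

∘H-identityʳ : ∀ {v w} (f : Hom v w) → f ∘H idH ≡ f
∘H-identityʳ (hom _ s) = hom-ext (trans (map-cong s actD-id) (map-id s))

infixr 9 _∘N_

_∘N_ : ∀ {F G H} → NatTrans G H → NatTrans F G → NatTrans F H
_∘N_ {H = H} s t = record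
  { η = λ w x → η s w (η t w x)
  ; η-cong = λ w e → η-cong s w (η-cong t w e)
  ; η-nat = λ f x → ≈.trans H (η-cong s _ (η-nat t f x)) (η-nat s f (η t _ x)) }

⟨_,_⟩ : ∀ {F G H} → NatTrans F G → NatTrans F H → NatTrans F (G ⊗ H)
⟨ s , t ⟩ = record
  { η = λ w x → η s w x , η t w x
  ; η-cong = λ w e → η-cong s w e , η-cong t w e
  ; η-nat = λ f x → η-nat s f x , η-nat t f x }

π₁ : ∀ {F G} → NatTrans (F ⊗ G) F
π₁ {F} = record { η = λ _ → proj₁ ; η-cong = λ _ → proj₁ ; η-nat = λ _ _ → ≈.refl F }

π₂ : ∀ {F G} → NatTrans (F ⊗ G) G
π₂ {G = G} = record { η = λ _ → proj₂ ; η-cong = λ _ → proj₂ ; η-nat = λ _ _ → ≈.refl G }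

swapN : ∀ {F G} → NatTrans (F ⊗ G) (G ⊗ F)
swapN = ⟨ π₂ , π₁ ⟩

projΠ𝔸 : ∀ {F : Atom → PSh} p → NatTrans (Π𝔸 F) (F p)
projΠ𝔸 {F} p = record { η = λ _ x → x p ; η-cong = λ _ e → e p ; η-nat = λ _ _ → ≈.refl (F p) }

tupleΠ𝔸 : ∀ {G} {F : Atom → PSh} → (∀ p → NatTrans G (F p)) → NatTrans G (Π𝔸 F)
tupleΠ𝔸 t = record
  { η = λ w x p → η (t p) w x
  ; η-cong = λ w e p → η-cong (t p) w e
  ; η-nat = λ f x p → η-nat (t p) f x }

curryN : ∀ {G A B} → NatTrans (G ⊗ A) B → NatTrans G (A ⇒ B)
curryN {G} {A} {B} t = record
  { η = λ w γ → record
      { fun = λ f x → η t _ (PSh.act G f γ , x)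
      ; fun-cong = λ f e → η-cong t _ (≈.refl G , e)
      ; fun-nat = λ f g x → ≈.trans B (η-cong t _ (PSh.act-∘ G f g γ , ≈.refl A))
                                      (η-nat t g (PSh.act G f γ , x)) }
  ; η-cong = λ w e f x → η-cong t _ (PSh.act-cong G f e , ≈.refl A)
  ; η-nat = λ h γ f x → η-cong t _ (≈.sym G (PSh.act-∘ G h f γ) , ≈.refl A) }

evalN : ∀ {A B} → NatTrans ((A ⇒ B) ⊗ A) B
evalN {A} {B} = record
  { η = λ _ (α , x) → fun α idH x
  ; η-cong = λ _ {x} {y} (eα , ex) → ≈.trans B (fun-cong (proj₁ x) idH ex) (eα idH (proj₂ y))
  ; η-nat = λ f (α , x) →
      subst (λ k → PSh._≈_ B (fun α k (PSh.act A f x)) (PSh.act B f (fun α idH x)))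
            (trans (idˡ f) (sym (∘H-identityʳ f)))
            (fun-nat α idH f x) }

appN : ∀ {G A B} → NatTrans G (A ⇒ B) → NatTrans G A → NatTrans G B
appN s t = evalN ∘N ⟨ s , t ⟩

postcompN : ∀ {A B C} → NatTrans B C → NatTrans (A ⇒ B) (A ⇒ C)
postcompN g = curryN (g ∘N evalN)

uncurry-swapN : ∀ {G A B C} → NatTrans G (A ⇒ (B ⇒ C)) → NatTrans (G ⊗ B) (A ⇒ C)
uncurry-swapN k = curryN (appN (appN (k ∘N π₁ ∘N π₁) π₂) (π₂ ∘N π₁))

Disj : PSh → PSh → PSh
Disj A B = Π𝔸 (λ p → (A ⇒ Atomic p) ⇒ ((B ⇒ Atomic p) ⇒ Atomic p))

inj₁N : ∀ {A B} → NatTrans A (Disj A B)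
inj₁N = tupleΠ𝔸 λ _ → curryN (curryN (appN (π₂ ∘N π₁) (π₁ ∘N π₁)))

inj₂N : ∀ {A B} → NatTrans B (Disj A B)
inj₂N = tupleΠ𝔸 λ _ → curryN (curryN (appN π₂ (π₁ ∘N π₁)))

infixr 6 _⊗ⁿ_
infixr 4 _⇒ⁿ_

data Negative : PSh → Set₂ where
  atomic : ∀ p → Negative (Atomic p)
  _⊗ⁿ_   : ∀ {F G} → Negative F → Negative G → Negative (F ⊗ G)
  Π𝔸ⁿ    : ∀ {F} → (∀ p → Negative (F p)) → Negative (Π𝔸 F)
  _⇒ⁿ_   : ∀ E {F} → Negative F → Negative (E ⇒ F)

negative⟦_⟧ : ∀ χ → Negative ⟦ χ ⟧
negative⟦ at p ⟧  = atomic p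
negative⟦ falsum ⟧ = Π𝔸ⁿ atomic
negative⟦ φ ∧ ψ ⟧ = negative⟦ φ ⟧ ⊗ⁿ negative⟦ ψ ⟧
negative⟦ φ ∨ ψ ⟧ = Π𝔸ⁿ λ p → (⟦ φ ⟧ ⇒ Atomic p) ⇒ⁿ (⟦ ψ ⟧ ⇒ Atomic p) ⇒ⁿ atomic p
negative⟦ φ ⊃ ψ ⟧ = ⟦ φ ⟧ ⇒ⁿ negative⟦ ψ ⟧

falsum-elim : ∀ {F} → Negative F → NatTrans (Π𝔸 Atomic) F
falsum-elim (atomic p) = projΠ𝔸 p
falsum-elim (m ⊗ⁿ n)   = ⟨ falsum-elim m , falsum-elim n ⟩
falsum-elim (Π𝔸ⁿ n)    = tupleΠ𝔸 λ p → falsum-elim (n p)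
falsum-elim (E ⇒ⁿ n)   = curryN (falsum-elim n ∘N π₁)

disj-elim : ∀ {F G A B} → Negative F → NatTrans G (Disj A B)
          → NatTrans G (A ⇒ F) → NatTrans G (B ⇒ F) → NatTrans G F
disj-elim {A = A} {B} (atomic p) d k₁ k₂ =
  appN (appN (projΠ𝔸 {λ p → (A ⇒ Atomic p) ⇒ ((B ⇒ Atomic p) ⇒ Atomic p)} p ∘N d) k₁) k₂
disj-elim (m ⊗ⁿ n) d k₁ k₂ =
  ⟨ disj-elim m d (postcompN π₁ ∘N k₁) (postcompN π₁ ∘N k₂)
  , disj-elim n d (postcompN π₂ ∘N k₁) (postcompN π₂ ∘N k₂) ⟩
disj-elim (Π𝔸ⁿ n) d k₁ k₂ =
  tupleΠ𝔸 λ p → disj-elim (n p) d (postcompN (projΠ𝔸 p) ∘N k₁) (postcompN (projΠ𝔸 p) ∘N k₂)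
disj-elim (E ⇒ⁿ n) d k₁ k₂ =
  curryN (disj-elim n (d ∘N π₁) (uncurry-swapN k₁) (uncurry-swapN k₂))

lookupN : ∀ {Γ φ} → φ ∈ Γ → NatTrans ⟦ Γ ⟧ᶜ ⟦ φ ⟧
lookupN (here refl) = π₁
lookupN (there i)   = lookupN i ∘N π₂

proposition16 : ∀ {Γ : FCtx} {φ : Formula} → Γ ⊢ φ → NatTrans ⟦ Γ ⟧ᶜ ⟦ φ ⟧
proposition16 (ax i)     = lookupN i
proposition16 (∧I s t)   = ⟨ proposition16 s , proposition16 t ⟩
proposition16 (∧E₁ t)    = π₁ ∘N proposition16 t
proposition16 (∧E₂ t)    = π₂ ∘N proposition16 t
proposition16 (∨I₁ t)    = inj₁N ∘N proposition16 t
proposition16 (∨I₂ t)    = inj₂N ∘N proposition16 t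
proposition16 (∨E {χ = χ} d t₁ t₂) =
  disj-elim negative⟦ χ ⟧ (proposition16 d)
    (curryN (proposition16 t₁ ∘N swapN)) (curryN (proposition16 t₂ ∘N swapN))
proposition16 (⊃I t)     = curryN (proposition16 t ∘N swapN)
proposition16 (⊃E s t)   = appN (proposition16 s) (proposition16 t)
proposition16 (⊥E {φ} t) = falsum-elim negative⟦ φ ⟧ ∘N proposition16 t
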